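{- Let $G$ be a $K_2$-hamiltonian graph and $(W,X)$ a non-trivial partition of $V(G)$ such that $W$ is an independent set. Suppose $v,w\in X$ are adjacent. Let $n_1$ be the number of vertices of $X\setminus\{v,w\}$ adjacent to exactly one vertex of $W$, and $n_2$ the number of vertices of $X\setminus\{v,w\}$ adjacent to at least two vertices of $W$. Then $2n_2+n_1\geq 2|W|$.
   Context: All graphs are finite, simple and connected. A graph is hamiltonian if it has a cycle through all its vertices; $G$ is $K_2$-hamiltonian if $G-u-v$ is hamiltonian for every pair of adjacent vertices $u,v$. A non-trivial partition $(W,X)$ of $V$ is a pair of disjoint non-empty sets with union $V$. -}

module Defs where

open import Data.Nat using (ℕ; zero; suc; _+_; _≤_; _≡ᵇ_; _≤ᵇ_)
open import Data.Fin using (Fin; zero; suc; _≟_)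
open import Data.Bool using (Bool; true; false; T; not; _∧_; if_then_else_)
open import Data.List using (List; []; _∷_; _∷ʳ_; length)
open import Data.List.Relation.Unary.Linked using (Linked)
open import Data.List.Relation.Unary.Unique.Propositional using (Unique)
open import Data.List.Membership.Propositional using (_∈_)
open import Data.Product using (Σ; ∃-syntax; _×_)
open import Data.Sum using (_⊎_)
open import Relation.Binary.PropositionalEquality using (_≡_; _≢_)
open import Relation.Nullary.Decidable using (⌊_⌋)
open import Function.Bundles using (_⇔_)

record Graph (n : ℕ) : Set where
  field
    adj    : Fin n → Fin n → Bool
    adj-sym : ∀ x y → adj x y ≡ adj y x
    adj-irrefl : ∀ x → adj x x ≡ false

open Graph public

Edge : ∀ {n} → Graph n → Fin n → Fin n → Set
Edge G x y = T (adj G x y)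

Connected : ∀ {n} → Graph n → Set
Connected {n} G = ∀ (x y : Fin n) →
  x ≡ y ⊎ (∃[ xs ] Linked (Edge G) (x ∷ xs ∷ʳ y))

HamiltonianOn : ∀ {n} → Graph n → (Fin n → Set) → Set
HamiltonianOn {n} G S = ∃[ x ] ∃[ xs ]
  ( 3 ≤ length (x ∷ xs)
  × Unique (x ∷ xs)
  × (∀ (y : Fin n) → (y ∈ (x ∷ xs)) ⇔ S y)
  × Linked (Edge G) (x ∷ xs ∷ʳ x))

K2Hamiltonian : ∀ {n} → Graph n → Set
K2Hamiltonian {n} G = ∀ (u v : Fin n) → Edge G u v →
  HamiltonianOn G (λ y → (y ≢ u) × (y ≢ v))

countB : ∀ {n} → (Fin n → Bool) → ℕ
countB {zero} f = 0
countB {suc n} f = (if f zero then 1 else 0) + countB (λ i → f (suc i))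

Independent : ∀ {n} → Graph n → (Fin n → Bool) → Set
Independent G W = ∀ x y → T (W x) → T (W y) → T (not (adj G x y))

NonTrivial : ∀ {n} → (Fin n → Bool) → Set
NonTrivial W = (∃[ x ] T (W x)) × (∃[ y ] T (not (W y)))

degIn : ∀ {n} → Graph n → (Fin n → Bool) → Fin n → ℕ
degIn G W x = countB (λ y → W y ∧ adj G x y)

inXminus : ∀ {n} → (Fin n → Bool) → Fin n → Fin n → Fin n → Bool
inXminus W v w x = not (W x) ∧ not ⌊ x ≟ v ⌋ ∧ not ⌊ x ≟ w ⌋

n₁ : ∀ {n} → Graph n → (Fin n → Bool) → Fin n → Fin n → ℕ
n₁ G W v w = countB (λ x → inXminus W v w x ∧ (degIn G W x ≡ᵇ 1))

n₂ : ∀ {n} → Graph n → (Fin n → Bool) → Fin n → Fin n → ℕ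
n₂ G W v w = countB (λ x → inXminus W v w x ∧ (2 ≤ᵇ degIn G W x))

-- Deleting the two ends of the edge vw leaves a hamiltonian cycle of G - v - w; it passes
-- through every vertex of W and of X ∖ {v,w}. As W is independent, both cycle-neighbours of
-- a vertex of W lie in X, so exactly 2|W| edges of the cycle join W to X. Counting these
-- edges at their ends in X instead, a vertex x of X ∖ {v,w} is the end of at most two of
-- them and of at most deg_W x of them, and Σ min(2, deg_W x) over X ∖ {v,w} is 2n₂ + n₁.

module Submission where

open import Algebra.Properties.CommutativeSemigroup using (interchange)
open import Data.Bool using (Bool; true; false; T; not; _∧_; if_then_else_)
open import Data.Bool.Properties using (T-≡; T-not-≡; T-∧; ∧-identityʳ)
open import Data.Empty using (⊥-elim)
open import Data.Fin using (Fin; zero; suc; _≟_)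
open import Data.List using (List; []; _∷_; _∷ʳ_; map; filter; allFin)
open import Data.List.Properties using (map-∘; map-cong; map-tabulate)
open import Data.List.Membership.Propositional using (_∈_; _∉_)
open import Data.List.Membership.Propositional.Properties using (∈-map⁺; ∈-filter⁺; ∈-filter⁻; ∈-allFin)
open import Data.List.Membership.Propositional.Properties.WithK using (unique∧set⇒bag)
import Data.List.Membership.DecPropositional as DecMembership
open import Data.List.Relation.Binary.BagAndSetEquality using (∼bag⇒↭)
open import Data.List.Relation.Binary.Permutation.Propositional using (_↭_; ↭-sym)
open import Data.List.Relation.Binary.Permutation.Propositional.Properties using (∷↭∷ʳ; ∈-resp-↭; map⁺)
open import Data.List.Relation.Unary.All as All using (All; []; _∷_)
open import Data.List.Relation.Unary.AllPairs using (_∷_)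
open import Data.List.Relation.Unary.Linked using (Linked; [-]; _∷_)
open import Data.List.Relation.Unary.Unique.Propositional using (Unique)
open import Data.List.Relation.Unary.Unique.Propositional.Properties using (allFin⁺; filter⁺)
open import Data.Nat using (ℕ; zero; suc; _+_; _*_; _≤_; _⊓_; z≤n; s≤s; _≤ᵇ_; _≡ᵇ_)
open import Data.Nat.ListAction using (sum)
open import Data.Nat.ListAction.Properties using (sum-↭)
open import Data.Nat.Properties
  using (+-comm; +-identityʳ; +-mono-≤; +-monoʳ-≤; *-zeroʳ; *-distribˡ-+; ≤-refl; ≤-trans;
         m≤m+n; m≤n+m; ⊓-glb; +-commutativeSemigroup; module ≤-Reasoning)
open import Data.Product using (_×_; _,_; proj₂; uncurry)
open import Data.Unit using (tt)
open import Function using (_∘_; flip; id)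
open import Function.Bundles using (_⇔_; mk⇔; Equivalence)
open import Relation.Binary.PropositionalEquality
  using (_≡_; _≢_; refl; sym; trans; cong; cong₂; subst; subst₂; ≢-sym; module ≡-Reasoning)
open import Relation.Nullary using (¬_; yes; no)
open import Relation.Nullary.Decidable using (⌊_⌋; toWitnessFalse; fromWitnessFalse)
open import Relation.Unary using (Decidable)

open import Defs

𝟙 : Bool → ℕ
𝟙 b = if b then 1 else 0

if-¬T : ∀ b {m : ℕ} → ¬ T b → (if b then m else 0) ≡ 0
if-¬T true  ¬b = ⊥-elim (¬b tt)
if-¬T false _  = refl

if-T : ∀ b {A : Set} {m k : A} → T b → (if b then m else k) ≡ m
if-T true _ = refl

𝟙≤1 : ∀ b → 𝟙 b ≤ 1
𝟙≤1 true  = ≤-refl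
𝟙≤1 false = z≤n

module _ {A : Set} where

  sum-map-+ : ∀ (f g : A → ℕ) xs →
              sum (map (λ x → f x + g x) xs) ≡ sum (map f xs) + sum (map g xs)
  sum-map-+ f g []       = refl
  sum-map-+ f g (x ∷ xs) =
    trans (cong (f x + g x +_) (sum-map-+ f g xs)) (interchange +-commutativeSemigroup (f x) (g x) _ _)

  sum-map-*ˡ : ∀ k (f : A → ℕ) xs → sum (map (λ x → k * f x) xs) ≡ k * sum (map f xs)
  sum-map-*ˡ k f []       = sym (*-zeroʳ k)
  sum-map-*ˡ k f (x ∷ xs) =
    trans (cong (k * f x +_) (sum-map-*ˡ k f xs)) (sym (*-distribˡ-+ k (f x) _))

  sum-map-mono : ∀ {P : A → Set} (f g : A → ℕ) → (∀ {x} → P x → f x ≤ g x) →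
                 ∀ {xs} → All P xs → sum (map f xs) ≤ sum (map g xs)
  sum-map-mono f g f≤g []         = z≤n
  sum-map-mono f g f≤g (px ∷ pxs) = +-mono-≤ (f≤g px) (sum-map-mono f g f≤g pxs)

  sum-map-↭ : ∀ (f : A → ℕ) {xs ys} → xs ↭ ys → sum (map f xs) ≡ sum (map f ys)
  sum-map-↭ f xs↭ys = sum-↭ (map⁺ f xs↭ys)

  sum-map-filter : ∀ {P : A → Set} (P? : Decidable P) (f : A → ℕ) →
                   (∀ x → ¬ P x → f x ≡ 0) → ∀ xs → sum (map f xs) ≡ sum (map f (filter P? xs))
  sum-map-filter P? f f≡0 []       = refl
  sum-map-filter P? f f≡0 (x ∷ xs) with P? x
  ... | yes _ = cong (f x +_) (sum-map-filter P? f f≡0 xs)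
  ... | no ¬px = trans (cong (_+ sum (map f xs)) (f≡0 x ¬px)) (sum-map-filter P? f f≡0 xs)

module _ {n : ℕ} where
  open DecMembership (_≟_ {n}) using (_∈?_)

  filter-allFin-↭ : ∀ {xs} → Unique xs → filter (_∈? xs) (allFin n) ↭ xs
  filter-allFin-↭ {xs} u = ∼bag⇒↭ (unique∧set⇒bag (filter⁺ (_∈? xs) (allFin⁺ n)) u
    (mk⇔ (proj₂ ∘ ∈-filter⁻ (_∈? xs) {xs = allFin n})
         (∈-filter⁺ (_∈? xs) {xs = allFin n} (∈-allFin _))))

  sum-allFin-support : ∀ (f : Fin n → ℕ) {xs} → Unique xs → (∀ x → x ∉ xs → f x ≡ 0) →
                       sum (map f (allFin n)) ≡ sum (map f xs)
  sum-allFin-support f {xs} u f≡0 =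
    trans (sum-map-filter (_∈? xs) f f≡0 (allFin n)) (sum-map-↭ f (filter-allFin-↭ u))

countB≡sum : ∀ {n} (f : Fin n → Bool) → countB f ≡ sum (map (𝟙 ∘ f) (allFin n))
countB≡sum {zero}  f = refl
countB≡sum {suc n} f = cong (𝟙 (f zero) +_) (trans (countB≡sum (f ∘ suc))
  (cong sum (trans (map-tabulate id (𝟙 ∘ f ∘ suc)) (sym (map-tabulate suc (𝟙 ∘ f))))))

𝟙≤countB : ∀ {n} (f : Fin n → Bool) a → 𝟙 (f a) ≤ countB f
𝟙≤countB f zero    = m≤m+n _ _
𝟙≤countB f (suc a) = ≤-trans (𝟙≤countB (f ∘ suc) a) (m≤n+m _ _)

𝟙+𝟙≤countB : ∀ {n} (f : Fin n → Bool) {a c} → a ≢ c → 𝟙 (f a) + 𝟙 (f c) ≤ countB f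
𝟙+𝟙≤countB f {zero}  {zero}  a≢c = ⊥-elim (a≢c refl)
𝟙+𝟙≤countB f {zero}  {suc c} _   = +-monoʳ-≤ (𝟙 (f zero)) (𝟙≤countB (f ∘ suc) c)
𝟙+𝟙≤countB f {suc a} {zero}  _   =
  subst (_≤ countB f) (+-comm (𝟙 (f zero)) (𝟙 (f (suc a))))
        (+-monoʳ-≤ (𝟙 (f zero)) (𝟙≤countB (f ∘ suc) a))
𝟙+𝟙≤countB f {suc a} {suc c} a≢c = ≤-trans (𝟙+𝟙≤countB (f ∘ suc) (a≢c ∘ cong suc)) (m≤n+m _ _)

record Corner (A : Set) : Set where
  constructor corner
  field
    prev cur next : A

open Corner

module _ {A : Set} where

  corners : A → A → List A → List (Corner A)
  corners a b []      = []
  corners a b (c ∷ l) = corner a b c ∷ corners b c l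

  steps : A → List A → List (A × A)
  steps a []      = []
  steps a (b ∷ l) = (a , b) ∷ steps b l

  -- One corner for each vertex of the cyclic sequence x, y, r₁, …, rₖ.
  cycleCorners : A → A → List A → List (Corner A)
  cycleCorners x y r = corners x y (r ∷ʳ x ∷ʳ y)

  inStep outStep : Corner A → A × A
  inStep  t = prev t , cur t
  outStep t = cur t , next t

  map-cur-corners : ∀ a b l z → map cur (corners a b (l ∷ʳ z)) ≡ b ∷ l
  map-cur-corners a b []      z = refl
  map-cur-corners a b (c ∷ l) z = cong (b ∷_) (map-cur-corners b c l z)

  map-inStep-corners : ∀ a b l z → map inStep (corners a b (l ∷ʳ z)) ≡ steps a (b ∷ l)
  map-inStep-corners a b []      z = refl
  map-inStep-corners a b (c ∷ l) z = cong ((a , b) ∷_) (map-inStep-corners b c l z)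

  map-outStep-corners : ∀ a b l → map outStep (corners a b l) ≡ steps b l
  map-outStep-corners a b []      = refl
  map-outStep-corners a b (c ∷ l) = cong ((b , c) ∷_) (map-outStep-corners b c l)

  steps-∷ʳ : ∀ a l p q → steps a (l ∷ʳ p ∷ʳ q) ≡ steps a (l ∷ʳ p) ∷ʳ (p , q)
  steps-∷ʳ a []      p q = refl
  steps-∷ʳ a (b ∷ l) p q = cong ((a , b) ∷_) (steps-∷ʳ b l p q)

  map-cur-cycleCorners : ∀ x y r → map cur (cycleCorners x y r) ↭ x ∷ y ∷ r
  map-cur-cycleCorners x y r =
    subst (_↭ x ∷ y ∷ r) (sym (map-cur-corners x y (r ∷ʳ x) y)) (↭-sym (∷↭∷ʳ x (y ∷ r)))

  map-outStep↭inStep : ∀ x y r → map outStep (cycleCorners x y r) ↭ map inStep (cycleCorners x y r)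
  map-outStep↭inStep x y r = subst₂ _↭_
    (sym (trans (map-outStep-corners x y (r ∷ʳ x ∷ʳ y)) (steps-∷ʳ y r x y)))
    (sym (map-inStep-corners x y (r ∷ʳ x) y))
    (↭-sym (∷↭∷ʳ (x , y) (steps y (r ∷ʳ x))))

  sum-cycleCorners-cur : ∀ (f : A → ℕ) x y r →
                         sum (map (f ∘ cur) (cycleCorners x y r)) ≡ sum (map f (x ∷ y ∷ r))
  sum-cycleCorners-cur f x y r =
    trans (cong sum (map-∘ (cycleCorners x y r))) (sum-map-↭ f (map-cur-cycleCorners x y r))

  -- Both sides sum F once over every edge of the cycle.
  sum-cycleCorners-shift : ∀ (F : A → A → ℕ) x y r →
    sum (map (λ t → F (cur t) (next t)) (cycleCorners x y r)) ≡
    sum (map (λ t → F (prev t) (cur t)) (cycleCorners x y r))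
  sum-cycleCorners-shift F x y r = begin
    sum (map (uncurry F ∘ outStep) ts)    ≡⟨ cong sum (map-∘ ts) ⟩
    sum (map (uncurry F) (map outStep ts)) ≡⟨ sum-map-↭ (uncurry F) (map-outStep↭inStep x y r) ⟩
    sum (map (uncurry F) (map inStep ts))  ≡⟨ cong sum (map-∘ ts) ⟨
    sum (map (uncurry F ∘ inStep) ts)     ∎
    where
    open ≡-Reasoning
    ts = cycleCorners x y r

  cycleCorners-cur∈ : ∀ x y r → All (λ t → cur t ∈ x ∷ y ∷ r) (cycleCorners x y r)
  cycleCorners-cur∈ x y r =
    All.tabulate (λ t∈ts → ∈-resp-↭ (map-cur-cycleCorners x y r) (∈-map⁺ cur t∈ts))

  IsPath : (A → A → Set) → Corner A → Set
  IsPath R t = R (prev t) (cur t) × R (cur t) (next t)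

  module _ {R : A → A → Set} where

    Linked-∷ʳ : ∀ l {p q} → Linked R (l ∷ʳ p) → R p q → Linked R (l ∷ʳ p ∷ʳ q)
    Linked-∷ʳ []          _           Rpq = Rpq ∷ [-]
    Linked-∷ʳ (a ∷ [])    (Rap ∷ [-]) Rpq = Rap ∷ Rpq ∷ [-]
    Linked-∷ʳ (a ∷ b ∷ l) (Rab ∷ Rl)  Rpq = Rab ∷ Linked-∷ʳ (b ∷ l) Rl Rpq

    corners-linked : ∀ a b l → Linked R (a ∷ b ∷ l) → All (IsPath R) (corners a b l)
    corners-linked a b []      _                = []
    corners-linked a b (c ∷ l) (Rab ∷ Rbc ∷ Rl) = (Rab , Rbc) ∷ corners-linked b c l (Rbc ∷ Rl)

    cycleCorners-linked : ∀ x y r → Linked R (x ∷ y ∷ r ∷ʳ x) → All (IsPath R) (cycleCorners x y r)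
    cycleCorners-linked x y r closed@(Rxy ∷ _) =
      corners-linked x y (r ∷ʳ x ∷ʳ y) (Linked-∷ʳ (x ∷ y ∷ r) closed Rxy)

  corners-apart : ∀ a b l {p q} → Unique (a ∷ b ∷ l) → All (p ≢_) (a ∷ b ∷ l) → All (q ≢_) (b ∷ l) →
                  All (λ t → prev t ≢ next t) (corners a b (l ∷ʳ p ∷ʳ q))
  corners-apart a b []      _                      (p≢a ∷ _)  (q≢b ∷ _)  = ≢-sym p≢a ∷ ≢-sym q≢b ∷ []
  corners-apart a b (c ∷ l) ((_ ∷ a≢c ∷ _) ∷ uniq) (_ ∷ p≢l) (_ ∷ q≢l) =
    a≢c ∷ corners-apart b c l uniq p≢l q≢l

  cycleCorners-apart : ∀ x y z r → Unique (x ∷ y ∷ z ∷ r) →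
                       All (λ t → prev t ≢ next t) (cycleCorners x y (z ∷ r))
  cycleCorners-apart x y z r (x≢l@(_ ∷ x≢z ∷ _) ∷ uniq@(y≢l ∷ _)) =
    x≢z ∷ corners-apart y z r uniq x≢l y≢l

2⊓-split : ∀ b d → 2 * 𝟙 (b ∧ (2 ≤ᵇ d)) + 𝟙 (b ∧ (d ≡ᵇ 1)) ≡ (if b then 2 ⊓ d else 0)
2⊓-split false d             = refl
2⊓-split true  0             = refl
2⊓-split true  1             = refl
2⊓-split true  (suc (suc d)) = refl

module Counting {n} (G : Graph n) (W : Fin n → Bool) where

  crossing : Fin n → Fin n → ℕ
  crossing p q = 𝟙 (not (W q) ∧ W p)

  edge-sym : ∀ {x y} → Edge G x y → Edge G y x
  edge-sym {x} {y} = subst T (adj-sym G x y)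

  degIn-pair : ∀ {a b c} → Edge G b a → Edge G b c → a ≢ c → 𝟙 (W a) + 𝟙 (W c) ≤ degIn G W b
  degIn-pair {a} {b} {c} ba bc a≢c =
    subst (_≤ degIn G W b) (cong₂ _+_ (adjacent a ba) (adjacent c bc))
          (𝟙+𝟙≤countB (λ y → W y ∧ adj G b y) a≢c)
    where
    adjacent : ∀ y → Edge G b y → 𝟙 (W y ∧ adj G b y) ≡ 𝟙 (W y)
    adjacent y by = cong 𝟙 (trans (cong (W y ∧_) (Equivalence.to T-≡ by)) (∧-identityʳ (W y)))

  W-apart : ∀ {a} → T (not (W a)) → ∀ {u} → T (W u) → u ≢ a
  W-apart a∉W u∈W refl = subst T (Equivalence.to T-not-≡ a∉W) u∈W

  module _ (indep : Independent G W) where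

    W-neighbour-∉W : ∀ {x y} → Edge G x y → W x ≡ true → W y ≡ false
    W-neighbour-∉W {x} {y} xy wx with W y in wy
    ... | false = refl
    ... | true  = ⊥-elim (subst T (Equivalence.to T-not-≡ ¬xy) xy)
      where ¬xy = indep x y (Equivalence.from T-≡ wx) (Equivalence.from T-≡ wy)

    two-exits : ∀ {a b c} → Edge G a b → Edge G b c →
                𝟙 (W b) + 𝟙 (W b) ≤ crossing b a + crossing b c
    two-exits {a} {b} {c} ab bc with W b in wb
    ... | false = z≤n
    ... | true rewrite W-neighbour-∉W (edge-sym ab) wb | W-neighbour-∉W bc wb = ≤-refl

  module _ (v w : Fin n) where

    capacity : Fin n → ℕ
    capacity x = if inXminus W v w x then 2 ⊓ degIn G W x else 0

    inXminus-intro : ∀ {x} → T (not (W x)) → x ≢ v → x ≢ w → T (inXminus W v w x)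
    inXminus-intro {x} x∉W x≢v x≢w = Equivalence.from (T-∧ {not (W x)})
      (x∉W , Equivalence.from (T-∧ {not ⌊ x ≟ v ⌋}) (fromWitnessFalse x≢v , fromWitnessFalse x≢w))

    inXminus-elim : ∀ {x} → T (inXminus W v w x) → x ≢ v × x ≢ w
    inXminus-elim {x} x∈
      with Equivalence.to (T-∧ {not ⌊ x ≟ v ⌋}) (proj₂ (Equivalence.to (T-∧ {not (W x)}) x∈))
    ... | x≢v , x≢w = toWitnessFalse {a? = x ≟ v} x≢v , toWitnessFalse {a? = x ≟ w} x≢w

    capacity-of-X : ∀ {x} → T (not (W x)) → x ≢ v → x ≢ w → capacity x ≡ 2 ⊓ degIn G W x
    capacity-of-X x∉W x≢v x≢w = if-T _ (inXminus-intro x∉W x≢v x≢w)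

    entries≤capacity : ∀ {a b c} → b ≢ v → b ≢ w → Edge G a b → Edge G b c → a ≢ c →
                       crossing a b + crossing c b ≤ capacity b
    entries≤capacity {a} {b} {c} b≢v b≢w ab bc a≢c = by-colour (W b) refl
      where
      by-colour : ∀ β → W b ≡ β → crossing a b + crossing c b ≤ capacity b
      by-colour true  b∈W rewrite b∈W = z≤n
      by-colour false b∉W rewrite capacity-of-X (Equivalence.from T-not-≡ b∉W) b≢v b≢w | b∉W =
        ⊓-glb (+-mono-≤ (𝟙≤1 (W a)) (𝟙≤1 (W c))) (degIn-pair (edge-sym ab) bc a≢c)

    sum-capacity : 2 * n₂ G W v w + n₁ G W v w ≡ sum (map capacity (allFin n))
    sum-capacity = begin
      2 * countB atLeastTwo + countB exactlyOne
        ≡⟨ cong₂ (λ s t → 2 * s + t) (countB≡sum atLeastTwo) (countB≡sum exactlyOne) ⟩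
      2 * sum (map (𝟙 ∘ atLeastTwo) vs) + sum (map (𝟙 ∘ exactlyOne) vs)
        ≡⟨ cong (_+ sum (map (𝟙 ∘ exactlyOne) vs)) (sum-map-*ˡ 2 (𝟙 ∘ atLeastTwo) vs) ⟨
      sum (map (λ x → 2 * 𝟙 (atLeastTwo x)) vs) + sum (map (𝟙 ∘ exactlyOne) vs)
        ≡⟨ sum-map-+ (λ x → 2 * 𝟙 (atLeastTwo x)) (𝟙 ∘ exactlyOne) vs ⟨
      sum (map (λ x → 2 * 𝟙 (atLeastTwo x) + 𝟙 (exactlyOne x)) vs)
        ≡⟨ cong sum (map-cong (λ x → 2⊓-split (inXminus W v w x) (degIn G W x)) vs) ⟩
      sum (map capacity vs) ∎
      where
      open ≡-Reasoning
      vs = allFin n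
      atLeastTwo exactlyOne : Fin n → Bool
      atLeastTwo x = inXminus W v w x ∧ (2 ≤ᵇ degIn G W x)
      exactlyOne x = inXminus W v w x ∧ (degIn G W x ≡ᵇ 1)

    module _ (indep : Independent G W) (v∉W : T (not (W v))) (w∉W : T (not (W w)))
             {x y z r} (uniq : Unique (x ∷ y ∷ z ∷ r))
             (mem : ∀ u → u ∈ x ∷ y ∷ z ∷ r ⇔ (u ≢ v × u ≢ w))
             (closed : Linked (Edge G) (x ∷ y ∷ z ∷ r ∷ʳ x)) where

      private
        C : List (Fin n)
        C = x ∷ y ∷ z ∷ r

        ts : List (Corner (Fin n))
        ts = cycleCorners x y (z ∷ r)

        ∑ : (Corner (Fin n) → ℕ) → ℕ
        ∑ f = sum (map f ts)

      corners-ok : All (λ t → (IsPath (Edge G) t × prev t ≢ next t) × cur t ∈ C) ts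
      corners-ok = All.zip (All.zip (cycleCorners-linked x y (z ∷ r) closed , cycleCorners-apart x y z r uniq)
                           , cycleCorners-cur∈ x y (z ∷ r))

      sum-over-cycle : ∀ f → (∀ u → u ∉ C → f u ≡ 0) → sum (map f (allFin n)) ≡ ∑ (f ∘ cur)
      sum-over-cycle f f≡0 =
        trans (sum-allFin-support f uniq f≡0) (sym (sum-cycleCorners-cur f x y (z ∷ r)))

      countB-W-on-cycle : countB W ≡ ∑ (𝟙 ∘ W ∘ cur)
      countB-W-on-cycle = trans (countB≡sum W) (sum-over-cycle (𝟙 ∘ W) (λ u u∉C →
        if-¬T (W u) (λ u∈W → u∉C (Equivalence.from (mem u) (W-apart v∉W u∈W , W-apart w∉W u∈W)))))

      capacity-off-cycle : ∀ u → u ∉ C → capacity u ≡ 0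
      capacity-off-cycle u u∉C =
        if-¬T (inXminus W v w u) (λ u∈X → u∉C (Equivalence.from (mem u) (inXminus-elim u∈X)))

      cycle-bound : 2 * countB W ≤ 2 * n₂ G W v w + n₁ G W v w
      cycle-bound = begin
        2 * countB W
          ≡⟨ cong (countB W +_) (+-identityʳ (countB W)) ⟩
        countB W + countB W
          ≡⟨ cong₂ _+_ countB-W-on-cycle countB-W-on-cycle ⟩
        ∑ (𝟙 ∘ W ∘ cur) + ∑ (𝟙 ∘ W ∘ cur)
          ≡⟨ sum-map-+ (𝟙 ∘ W ∘ cur) (𝟙 ∘ W ∘ cur) ts ⟨
        ∑ (λ t → 𝟙 (W (cur t)) + 𝟙 (W (cur t)))
          ≤⟨ sum-map-mono _ _ (λ (((pc , cn) , _) , _) → two-exits indep pc cn) corners-ok ⟩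
        ∑ (λ t → crossing (cur t) (prev t) + crossing (cur t) (next t))
          ≡⟨ sum-map-+ (λ t → crossing (cur t) (prev t)) (λ t → crossing (cur t) (next t)) ts ⟩
        ∑ (λ t → crossing (cur t) (prev t)) + ∑ (λ t → crossing (cur t) (next t))
          ≡⟨ cong₂ _+_ (sym (sum-cycleCorners-shift (flip crossing) x y (z ∷ r)))
                       (sum-cycleCorners-shift crossing x y (z ∷ r)) ⟩
        ∑ (λ t → crossing (next t) (cur t)) + ∑ (λ t → crossing (prev t) (cur t))
          ≡⟨ +-comm (∑ (λ t → crossing (next t) (cur t))) _ ⟩
        ∑ (λ t → crossing (prev t) (cur t)) + ∑ (λ t → crossing (next t) (cur t))
          ≡⟨ sum-map-+ (λ t → crossing (prev t) (cur t)) (λ t → crossing (next t) (cur t)) ts ⟨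
        ∑ (λ t → crossing (prev t) (cur t) + crossing (next t) (cur t))
          ≤⟨ sum-map-mono _ _ (λ (((pc , cn) , p≢n) , c∈C) →
               let c≢v , c≢w = Equivalence.to (mem _) c∈C in entries≤capacity c≢v c≢w pc cn p≢n)
             corners-ok ⟩
        ∑ (capacity ∘ cur)
          ≡⟨ sum-over-cycle capacity capacity-off-cycle ⟨
        sum (map capacity (allFin n))
          ≡⟨ sum-capacity ⟨
        2 * n₂ G W v w + n₁ G W v w ∎
        where open ≤-Reasoning

open Counting using (cycle-bound)

lemma4 : ∀ {n : ℕ} (G : Graph n) → Connected G → K2Hamiltonian G →
    (W : Fin n → Bool) → NonTrivial W → Independent G W →
    (v w : Fin n) → T (not (W v)) → T (not (W w)) → Edge G v w →
    2 * countB W ≤ 2 * n₂ G W v w + n₁ G W v w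
lemma4 G _ k2 W _ indep v w v∉W w∉W vw with k2 v w vw
... | _ , []        , s≤s ()       , _
... | _ , _ ∷ []    , s≤s (s≤s ()) , _
... | x , y ∷ z ∷ r , _            , uniq , mem , closed =
  cycle-bound G W v w indep v∉W w∉W uniq mem closed
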